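{- Let $G$ be a graph with $\operatorname{diam}(G)\le 3$ and let $\pi$ be either $\mu$ or $\mathrm{gp}$. Then $\chi_\pi(G)\le\chi(G)$ and $\chi_{\pi_i}(G)\le \chi(G)$.
   Context: A set $S$ is in general position ($\mathrm{gp}$) if no shortest path contains more than two vertices of $S$; a mutual-visibility set ($\mu$) if for any $u,v\in S$ some shortest $u,v$-path avoids $S\setminus\{u,v\}$. $\mathrm{gp}_i$- and $\mu_i$-sets are such sets that are also independent. $\chi_\pi(G)$ is the minimum number of colours in a colouring of $V(G)$ whose colour classes are all $\pi$-sets; $\chi(G)$ is the chromatic number. -}

module Defs where

open import Data.Nat using (ℕ; zero; suc; _≤_)
open import Data.Fin using (Fin)
open import Data.Product using (Σ; _×_; _,_; ∃)
open import Data.Sum using (_⊎_)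
open import Relation.Nullary using (¬_)
open import Relation.Binary using (Decidable)
open import Relation.Binary.PropositionalEquality using (_≡_)

record Graph (n : ℕ) : Set₁ where
  field
    Adj   : Fin n → Fin n → Set
    sym   : ∀ {u v} → Adj u v → Adj v u
    irrefl : ∀ {u} → ¬ Adj u u
    dec   : Decidable Adj

data Prop : Set where
  μ gp : Prop

module _ {n : ℕ} (G : Graph n) where
  open Graph G

  data Walk : Fin n → Fin n → Set where
    [] : ∀ {u} → Walk u u
    step : ∀ {u v w} → Adj u v → Walk v w → Walk u w

  len : ∀ {u v} → Walk u v → ℕ
  len [] = zero
  len (step _ p) = suc (len p)

  data OnWalk (x : Fin n) : ∀ {u v} → Walk u v → Set where
    here  : ∀ {v} {p : Walk x v} → OnWalk x p
    there : ∀ {u v w} {e : Adj u v} {p : Walk v w} → OnWalk x p → OnWalk x (step e p)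

  -- A shortest u,v-path: a u,v-walk of minimum length (necessarily a path).
  IsShortest : ∀ {u v} → Walk u v → Set
  IsShortest {u} {v} p = ∀ (q : Walk u v) → len p ≤ len q

  DiamAtMost3 : Set
  DiamAtMost3 = ∀ u v → Σ (Walk u v) λ p → len p ≤ 3

  VSet : Set₁
  VSet = Fin n → Set

  IsGP : VSet → Set
  IsGP S = ∀ x y z → S x → S y → S z → ¬ x ≡ y → ¬ y ≡ z → ¬ x ≡ z →
           ∀ {u v} (p : Walk u v) → IsShortest p →
           ¬ (OnWalk x p × OnWalk y p × OnWalk z p)

  IsMV : VSet → Set
  IsMV S = ∀ u v → S u → S v →
           Σ (Walk u v) λ p → IsShortest p ×
             (∀ x → OnWalk x p → S x → x ≡ u ⊎ x ≡ v)

  Independent : VSet → Set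
  Independent S = ∀ x y → S x → S y → ¬ Adj x y

  IsPiSet : Prop → VSet → Set
  IsPiSet μ S = IsMV S
  IsPiSet gp S = IsGP S

  IsPiISet : Prop → VSet → Set
  IsPiISet π S = IsPiSet π S × Independent S

  Class : ∀ {k} → (Fin n → Fin k) → Fin k → VSet
  Class c i x = c x ≡ i

  Colourable : ℕ → Set
  Colourable k = Σ (Fin n → Fin k) λ c → ∀ x y → Adj x y → ¬ c x ≡ c y

  PiColourable : Prop → ℕ → Set
  PiColourable π k = Σ (Fin n → Fin k) λ c → ∀ i → IsPiSet π (Class c i)

  PiIColourable : Prop → ℕ → Set
  PiIColourable π k = Σ (Fin n → Fin k) λ c → ∀ i → IsPiISet π (Class c i)

-- Colour the graph properly; each colour class is then independent. In a graph
-- of diameter at most 3 every shortest path has at most four vertices, and of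
-- three distinct vertices among four consecutive ones on a path two are
-- neighbours on the path. So a shortest path meets an independent set in at
-- most two vertices, which makes it a general-position set; and a shortest
-- u,v-path between two of its members meets it only in u and v, which makes it
-- a mutual-visibility set.
module Submission where

open import Defs
open import Data.Nat using (ℕ; zero; suc; _≤_; z≤n; s≤s; ⌊_/2⌋)
open import Data.Nat.Properties
  using (≤-trans; ≰⇒>; m≤n⇒m≤1+n; suc-injective; ⌊n/2⌋-mono)
open import Data.Fin using (Fin; _≟_)
open import Data.Fin.Properties using (any?)
open import Data.Product using (Σ; _×_; _,_)
open import Data.Sum using (_⊎_; inj₁; inj₂) renaming (map to ⊎-map)
open import Data.Empty using (⊥-elim)
open import Function using (_∘_)
open import Relation.Nullary using (¬_; Dec; yes; no)
open import Relation.Nullary.Decidable using (_×-dec_)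
open import Relation.Binary.PropositionalEquality using (_≡_; _≢_; refl; sym; trans; cong)

Consecutive : ℕ → ℕ → Set
Consecutive i j = suc i ≡ j ⊎ suc j ≡ i

distinct-same-half⇒consecutive : ∀ {i j} → i ≢ j → ⌊ i /2⌋ ≡ ⌊ j /2⌋ → Consecutive i j
distinct-same-half⇒consecutive {zero}        {zero}        i≢j _  = ⊥-elim (i≢j refl)
distinct-same-half⇒consecutive {zero}        {suc zero}    _   _  = inj₁ refl
distinct-same-half⇒consecutive {suc zero}    {zero}        _   _  = inj₂ refl
distinct-same-half⇒consecutive {suc zero}    {suc zero}    i≢j _  = ⊥-elim (i≢j refl)
distinct-same-half⇒consecutive {suc (suc i)} {suc (suc j)} i≢j eq =
  ⊎-map (cong (suc ∘ suc)) (cong (suc ∘ suc))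
    (distinct-same-half⇒consecutive (i≢j ∘ cong (suc ∘ suc)) (suc-injective eq))
distinct-same-half⇒consecutive {zero}        {suc (suc _)} _   ()
distinct-same-half⇒consecutive {suc zero}    {suc (suc _)} _   ()
distinct-same-half⇒consecutive {suc (suc _)} {zero}        _   ()
distinct-same-half⇒consecutive {suc (suc _)} {suc zero}    _   ()

two-of-three-≤1-equal : ∀ {a b c} → a ≤ 1 → b ≤ 1 → c ≤ 1 → a ≡ b ⊎ b ≡ c ⊎ a ≡ c
two-of-three-≤1-equal z≤n       z≤n       _         = inj₁ refl
two-of-three-≤1-equal (s≤s z≤n) (s≤s z≤n) _         = inj₁ refl
two-of-three-≤1-equal z≤n       (s≤s z≤n) z≤n       = inj₂ (inj₂ refl)
two-of-three-≤1-equal z≤n       (s≤s z≤n) (s≤s z≤n) = inj₂ (inj₁ refl)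
two-of-three-≤1-equal (s≤s z≤n) z≤n       z≤n       = inj₂ (inj₁ refl)
two-of-three-≤1-equal (s≤s z≤n) z≤n       (s≤s z≤n) = inj₂ (inj₂ refl)

-- Pigeonhole on the halves ⌊·/2⌋ ∈ {0,1}: the blocks {0,1} and {2,3} consist of
-- consecutive numbers.
three-distinct-≤3⇒consecutive-pair : ∀ {i j k} → i ≤ 3 → j ≤ 3 → k ≤ 3 →
  i ≢ j → j ≢ k → i ≢ k → Consecutive i j ⊎ Consecutive j k ⊎ Consecutive i k
three-distinct-≤3⇒consecutive-pair i≤3 j≤3 k≤3 i≢j j≢k i≢k
  with two-of-three-≤1-equal (⌊n/2⌋-mono i≤3) (⌊n/2⌋-mono j≤3) (⌊n/2⌋-mono k≤3)
... | inj₁ ij        = inj₁ (distinct-same-half⇒consecutive i≢j ij)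
... | inj₂ (inj₁ jk) = inj₂ (inj₁ (distinct-same-half⇒consecutive j≢k jk))
... | inj₂ (inj₂ ik) = inj₂ (inj₂ (distinct-same-half⇒consecutive i≢k ik))

module _ {n : ℕ} (G : Graph n) where
  open Graph G renaming (sym to Adj-sym)

  index : ∀ {x u v} {p : Walk G u v} → OnWalk G x p → ℕ
  index here      = zero
  index (there o) = suc (index o)

  index≤len : ∀ {x u v} {p : Walk G u v} (o : OnWalk G x p) → index o ≤ len G p
  index≤len here      = z≤n
  index≤len (there o) = s≤s (index≤len o)

  index-injective : ∀ {x y u v} {p : Walk G u v} (o : OnWalk G x p) (o′ : OnWalk G y p) →
                    index o ≡ index o′ → x ≡ y
  index-injective here      here       _  = refl
  index-injective (there o) (there o′) eq = index-injective o o′ (suc-injective eq)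

  index-suc⇒Adj : ∀ {x y u v} {p : Walk G u v} (o : OnWalk G x p) (o′ : OnWalk G y p) →
                  suc (index o) ≡ index o′ → Adj x y
  index-suc⇒Adj {p = step e _} here (there here) _ = e
  index-suc⇒Adj (there o) (there o′) eq = index-suc⇒Adj o o′ (suc-injective eq)
  index-suc⇒Adj here (there (there _)) ()

  consecutive⇒Adj : ∀ {x y u v} {p : Walk G u v} (o : OnWalk G x p) (o′ : OnWalk G y p) →
                    Consecutive (index o) (index o′) → Adj x y
  consecutive⇒Adj o o′ (inj₁ eq) = index-suc⇒Adj o o′ eq
  consecutive⇒Adj o o′ (inj₂ eq) = Adj-sym (index-suc⇒Adj o′ o eq)

  three-on-short-walk⇒Adj : ∀ {x y z u v} {p : Walk G u v} → len G p ≤ 3 →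
    OnWalk G x p → OnWalk G y p → OnWalk G z p → x ≢ y → y ≢ z → x ≢ z →
    Adj x y ⊎ Adj y z ⊎ Adj x z
  three-on-short-walk⇒Adj p≤3 ox oy oz x≢y y≢z x≢z
    with three-distinct-≤3⇒consecutive-pair
           (≤-trans (index≤len ox) p≤3) (≤-trans (index≤len oy) p≤3) (≤-trans (index≤len oz) p≤3)
           (x≢y ∘ index-injective ox oy) (y≢z ∘ index-injective oy oz) (x≢z ∘ index-injective ox oz)
  ... | inj₁ xy        = inj₁ (consecutive⇒Adj ox oy xy)
  ... | inj₂ (inj₁ yz) = inj₂ (inj₁ (consecutive⇒Adj oy oz yz))
  ... | inj₂ (inj₂ xz) = inj₂ (inj₂ (consecutive⇒Adj ox oz xz))

  end-on-walk : ∀ {u v} (p : Walk G u v) → OnWalk G v p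
  end-on-walk []         = here
  end-on-walk (step _ p) = there (end-on-walk p)

  on-shortest-loop : ∀ {x u} {p : Walk G u u} → IsShortest G p → OnWalk G x p → x ≡ u
  on-shortest-loop {p = []}       _  here = refl
  on-shortest-loop {p = step _ _} sh _    with sh []
  ... | ()

  WalkWithin : ℕ → Fin n → Fin n → Set
  WalkWithin k u v = Σ (Walk G u v) λ p → len G p ≤ k

  walkWithin? : ∀ k u v → Dec (WalkWithin k u v)
  walkWithin? zero u v with u ≟ v
  ... | yes refl = yes ([] , z≤n)
  ... | no u≢v   = no λ { ([] , _) → u≢v refl }
  walkWithin? (suc k) u v with u ≟ v | any? (λ w → dec u w ×-dec walkWithin? k w v)
  ... | yes refl | _                      = yes ([] , z≤n)
  ... | no _     | yes (w , e , p , p≤k)  = yes (step e p , s≤s p≤k)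
  ... | no u≢v   | no ¬via                = no λ
    { ([] , _)              → u≢v refl
    ; (step e p , s≤s p≤k) → ¬via (_ , e , p , p≤k) }

  ShortestWithin : ℕ → Fin n → Fin n → Set
  ShortestWithin k u v = Σ (Walk G u v) λ p → IsShortest G p × len G p ≤ k

  shortest-within : ∀ k {u v} → WalkWithin k u v → ShortestWithin k u v
  shortest-within zero (p , p≤0) = p , (λ _ → ≤-trans p≤0 z≤n) , p≤0
  shortest-within (suc k) {u} {v} (p , p≤1+k) with walkWithin? k u v
  ... | yes shorter = let (q , q-shortest , q≤k) = shortest-within k shorter
                      in q , q-shortest , m≤n⇒m≤1+n q≤k
  ... | no ¬shorter = p , (λ q → ≤-trans p≤1+k (≰⇒> (λ q≤k → ¬shorter (q , q≤k)))) , p≤1+k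

  shortest-len≤3 : DiamAtMost3 G → ∀ {u v} {p : Walk G u v} → IsShortest G p → len G p ≤ 3
  shortest-len≤3 diam {u} {v} p-shortest =
    let (q , q≤3) = diam u v in ≤-trans (p-shortest q) q≤3

  module _ {S : VSet G} (S-independent : Independent G S) where

    independent⇒gp-on-short-walk : ∀ {u v} {p : Walk G u v} → len G p ≤ 3 →
      ∀ x y z → S x → S y → S z → x ≢ y → y ≢ z → x ≢ z →
      ¬ (OnWalk G x p × OnWalk G y p × OnWalk G z p)
    independent⇒gp-on-short-walk p≤3 x y z sx sy sz x≢y y≢z x≢z (ox , oy , oz)
      with three-on-short-walk⇒Adj p≤3 ox oy oz x≢y y≢z x≢z
    ... | inj₁ xy        = S-independent x y sx sy xy
    ... | inj₂ (inj₁ yz) = S-independent y z sy sz yz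
    ... | inj₂ (inj₂ xz) = S-independent x z sx sz xz

    on-short-shortest-walk⇒endpoint : ∀ {u v} (p : Walk G u v) → IsShortest G p → len G p ≤ 3 →
      S u → S v → ∀ x → OnWalk G x p → S x → x ≡ u ⊎ x ≡ v
    on-short-shortest-walk⇒endpoint {u} {v} p p-shortest p≤3 su sv x ox sx
      with x ≟ u | x ≟ v | u ≟ v
    ... | yes x≡u | _       | _        = inj₁ x≡u
    ... | no _    | yes x≡v | _        = inj₂ x≡v
    ... | no _    | no _    | yes refl = inj₁ (on-shortest-loop p-shortest ox)
    ... | no x≢u  | no x≢v  | no u≢v   = ⊥-elim
      (independent⇒gp-on-short-walk p≤3 u x v su sx sv (x≢u ∘ sym) x≢v u≢v (here , ox , end-on-walk p))

    independent⇒IsGP : DiamAtMost3 G → IsGP G S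
    independent⇒IsGP diam x y z sx sy sz x≢y y≢z x≢z p p-shortest =
      independent⇒gp-on-short-walk (shortest-len≤3 diam p-shortest) x y z sx sy sz x≢y y≢z x≢z

    independent⇒IsMV : DiamAtMost3 G → IsMV G S
    independent⇒IsMV diam u v su sv =
      let (p , p-shortest , p≤3) = shortest-within 3 (diam u v)
      in p , p-shortest , on-short-shortest-walk⇒endpoint p p-shortest p≤3 su sv

    independent⇒IsPiSet : DiamAtMost3 G → ∀ π → IsPiSet G π S
    independent⇒IsPiSet diam μ  = independent⇒IsMV diam
    independent⇒IsPiSet diam gp = independent⇒IsGP diam

  proper-colour-class-independent : ∀ {k} (c : Fin n → Fin k) → (∀ x y → Adj x y → c x ≢ c y) →
                                    ∀ i → Independent G (Class G c i)
  proper-colour-class-independent c proper i x y cx≡i cy≡i xy = proper x y xy (trans cx≡i (sym cy≡i))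

mainTheorem11 : ∀ {n} (G : Graph n) → DiamAtMost3 G → (π : Prop) →
    ∀ (k : ℕ) → Colourable G k → PiColourable G π k × PiIColourable G π k
mainTheorem11 G diam π k (c , proper) =
  (c , piSet) , (c , λ i → piSet i , independent i)
  where
    independent : ∀ i → Independent G (Class G c i)
    independent = proper-colour-class-independent G c proper
    piSet : ∀ i → IsPiSet G π (Class G c i)
    piSet i = independent⇒IsPiSet G (independent i) diam π
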